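{- Let $H$ be a long prism, a pyramid, a theta, or a broken wheel. Then $H$ contains either $P_4+P_1$ or $C_4$ as an induced subgraph.
   Context: All graphs are finite, simple and undirected; a path has length equal to its number of edges. A prism is a graph made of three vertex-disjoint chordless paths $a_1\ldots b_1$, $a_2\ldots b_2$, $a_3\ldots b_3$ of length at least 1 such that $\{a_1,a_2,a_3\}$ and $\{b_1,b_2,b_3\}$ are triangles and there are no edges between the paths other than those of the two triangles; it is long if at least one path has length at least 2. A pyramid is a graph made of three chordless paths $a\ldots b_1$, $a\ldots b_2$, $a\ldots b_3$ of length at least 1, at least two of length at least 2, pairwise vertex-disjoint except at $a$, such that $\{b_1,b_2,b_3\}$ is a triangle and no edges exist between the paths except those of the triangle and the three edges incident to $a$. A theta is a graph made of three internally vertex-disjoint chordless paths of length at least 2 with common extremities $a,b$ such that no edges exist between the paths except the three edges incident to $a$ and the three incident to $b$. A hole is a chordless cycle of length at least 4. A wheel $(H,x)$ consists of a hole $H$ and a vertex $x$ with at least three neighbors on $H$; a sector is a subpath of $H$ between two consecutive neighbors of $x$; the wheel is broken if at least two sectors have length at least 2. $P_4+P_1$ is the disjoint union of the 4-vertex path and a single vertex. -}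

module Defs where

open import Data.Nat using (ℕ; zero; suc; _+_; _≤_; _<_; NonZero)
open import Data.Nat.DivMod using (_%_; m%n<n)
open import Data.Fin using (Fin; toℕ; fromℕ<)
open import Data.Bool using (Bool; true; false)
open import Data.List using (List; []; _∷_; _++_; _∷ʳ_; length)
open import Data.List.Membership.Propositional using (_∈_)
open import Data.List.Relation.Unary.Unique.Propositional using (Unique)
open import Data.Product using (Σ; ∃; ∃-syntax; _×_; _,_)
open import Data.Sum using (_⊎_)
open import Relation.Binary.PropositionalEquality using (_≡_; _≢_)
open import Relation.Nullary using (¬_)
open import Function.Bundles using (_⇔_)

record Graph : Set where
  field
    n   : ℕ
    adj : Fin n → Fin n → Bool

open Graph public

V : Graph → Set
V G = Fin (n G)

E : (G : Graph) → V G → V G → Set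
E G u v = adj G u v ≡ true

SimpleGraph : Graph → Set
SimpleGraph G = (∀ u v → adj G u v ≡ adj G v u) × (∀ u → adj G u u ≡ false)

ContainsInduced : Graph → Graph → Set
ContainsInduced G F =
  Σ (V F → V G) λ f →
    (∀ i j → f i ≡ f j → i ≡ j) × (∀ i j → adj F i j ≡ adj G (f i) (f j))

p4p1-adj : ℕ → ℕ → Bool
p4p1-adj 0 1 = true
p4p1-adj 1 0 = true
p4p1-adj 1 2 = true
p4p1-adj 2 1 = true
p4p1-adj 2 3 = true
p4p1-adj 3 2 = true
p4p1-adj _ _ = false

-- P4 = 0-1-2-3, plus isolated vertex 4
P4+P1 : Graph
P4+P1 = record { n = 5 ; adj = λ i j → p4p1-adj (toℕ i) (toℕ j) }

c4-adj : ℕ → ℕ → Bool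
c4-adj 0 1 = true
c4-adj 1 0 = true
c4-adj 1 2 = true
c4-adj 2 1 = true
c4-adj 2 3 = true
c4-adj 3 2 = true
c4-adj 3 0 = true
c4-adj 0 3 = true
c4-adj _ _ = false

C4 : Graph
C4 = record { n = 4 ; adj = λ i j → c4-adj (toℕ i) (toℕ j) }

-- Paths given as lists of vertices; consecutive pairs are path edges.

data Consec {A : Set} : List A → A → A → Set where
  here  : ∀ {x y xs} → Consec (x ∷ y ∷ xs) x y
  there : ∀ {x xs u v} → Consec xs u v → Consec (x ∷ xs) u v

PathEdge : {A : Set} → List A → A → A → Set
PathEdge p u v = Consec p u v ⊎ Consec p v u

InTriangle : {A : Set} → A → A → A → A → A → Set
InTriangle x y z u v =
  ((u ≡ x ⊎ u ≡ y ⊎ u ≡ z) × (v ≡ x ⊎ v ≡ y ⊎ v ≡ z)) × u ≢ v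

NonEmpty : {A : Set} → List A → Set
NonEmpty l = 1 ≤ length l

-- Prism: paths a_i - m_i - b_i (vertex lists a_i ∷ m_i ∷ʳ b_i, length ≥ 1),
-- pairwise disjoint, covering G, and the edges of G are exactly the path
-- edges and the two triangles {a1,a2,a3}, {b1,b2,b3}.

IsPrismWith : (G : Graph) → (a₁ b₁ a₂ b₂ a₃ b₃ : V G) → (m₁ m₂ m₃ : List (V G)) → Set
IsPrismWith G a₁ b₁ a₂ b₂ a₃ b₃ m₁ m₂ m₃ =
  let P₁ = a₁ ∷ m₁ ∷ʳ b₁
      P₂ = a₂ ∷ m₂ ∷ʳ b₂
      P₃ = a₃ ∷ m₃ ∷ʳ b₃
      L  = P₁ ++ P₂ ++ P₃
  in Unique L × (∀ v → v ∈ L) ×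
     (∀ u v → E G u v ⇔
        (PathEdge P₁ u v ⊎ PathEdge P₂ u v ⊎ PathEdge P₃ u v
         ⊎ InTriangle a₁ a₂ a₃ u v ⊎ InTriangle b₁ b₂ b₃ u v))

-- long: at least one path has length ≥ 2
IsLongPrism : Graph → Set
IsLongPrism G =
  ∃[ a₁ ] ∃[ b₁ ] ∃[ a₂ ] ∃[ b₂ ] ∃[ a₃ ] ∃[ b₃ ] ∃[ m₁ ] ∃[ m₂ ] ∃[ m₃ ]
    IsPrismWith G a₁ b₁ a₂ b₂ a₃ b₃ m₁ m₂ m₃ ×
    (NonEmpty m₁ ⊎ NonEmpty m₂ ⊎ NonEmpty m₃)

-- Pyramid: paths a ∷ m_i ∷ʳ b_i, disjoint except at a, covering G,
-- at least two of length ≥ 2, edges = path edges + triangle {b1,b2,b3}.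

IsPyramid : Graph → Set
IsPyramid G =
  ∃[ a ] ∃[ b₁ ] ∃[ b₂ ] ∃[ b₃ ] ∃[ m₁ ] ∃[ m₂ ] ∃[ m₃ ]
    (let P₁ = a ∷ m₁ ∷ʳ b₁
         P₂ = a ∷ m₂ ∷ʳ b₂
         P₃ = a ∷ m₃ ∷ʳ b₃
         L  = a ∷ (m₁ ∷ʳ b₁) ++ (m₂ ∷ʳ b₂) ++ (m₃ ∷ʳ b₃)
     in Unique L × (∀ v → v ∈ L) ×
        ((NonEmpty m₁ × NonEmpty m₂) ⊎ (NonEmpty m₁ × NonEmpty m₃)
           ⊎ (NonEmpty m₂ × NonEmpty m₃)) ×
        (∀ u v → E G u v ⇔
           (PathEdge P₁ u v ⊎ PathEdge P₂ u v ⊎ PathEdge P₃ u v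
            ⊎ InTriangle b₁ b₂ b₃ u v)))

-- Theta: paths a ∷ m_i ∷ʳ b, all of length ≥ 2, internally disjoint,
-- covering G, edges = path edges.

IsTheta : Graph → Set
IsTheta G =
  ∃[ a ] ∃[ b ] ∃[ m₁ ] ∃[ m₂ ] ∃[ m₃ ]
    (let P₁ = a ∷ m₁ ∷ʳ b
         P₂ = a ∷ m₂ ∷ʳ b
         P₃ = a ∷ m₃ ∷ʳ b
         L  = a ∷ b ∷ m₁ ++ m₂ ++ m₃
     in Unique L × (∀ v → v ∈ L) ×
        NonEmpty m₁ × NonEmpty m₂ × NonEmpty m₃ ×
        (∀ u v → E G u v ⇔
           (PathEdge P₁ u v ⊎ PathEdge P₂ u v ⊎ PathEdge P₃ u v)))

-- Broken wheel.  The hole is c : Fin k → V G (injective, k ≥ 4), with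
-- c i adjacent to c j iff j ≡ i+1 (mod k) or i ≡ j+1 (mod k).

cyc : (k : ℕ) .{{_ : NonZero k}} → ℕ → Fin k
cyc k m = fromℕ< (m%n<n m k)

-- the subpath c_i, c_{i+1}, ..., c_{i+d} (indices mod k) is a sector of
-- (H , x) of length d: both ends are neighbours of x, no interior vertex is.
IsSector : (G : Graph) (k : ℕ) .{{_ : NonZero k}} → (Fin k → V G) → V G →
           Fin k → ℕ → Set
IsSector G k c x i d =
  1 ≤ d × E G x (c i) × E G x (c (cyc k (toℕ i + d))) ×
  (∀ t → 1 ≤ t → t < d → ¬ E G x (c (cyc k (toℕ i + t))))

IsBrokenWheel : Graph → Set
IsBrokenWheel G =
  Σ ℕ λ k' → let k = suc (suc (suc (suc k'))) in
  Σ (Fin k → V G) λ c → Σ (V G) λ x →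
    (∀ i j → c i ≡ c j → i ≡ j) ×
    (∀ i j → E G (c i) (c j) ⇔
       (toℕ j ≡ (toℕ i + 1) % k ⊎ toℕ i ≡ (toℕ j + 1) % k)) ×
    (∀ i → c i ≢ x) ×
    (∀ v → v ≡ x ⊎ ∃[ i ] v ≡ c i) ×
    (∃[ i ] ∃[ j ] ∃[ l ] i ≢ j × i ≢ l × j ≢ l ×
       E G x (c i) × E G x (c j) × E G x (c l)) ×
    (∃[ i ] ∃[ d ] ∃[ i' ] ∃[ d' ] i ≢ i' × 2 ≤ d × 2 ≤ d' ×
       IsSector G k c x i d × IsSector G k c x i' d')

-- All four graphs consist of chordless paths whose only further edges join
-- their ends, so vertices on different paths are adjacent only near the ends.
-- Two short pieces close up into an induced C4: two paths of length 2 of a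
-- theta, two rungs of length 1 of a prism, paths of lengths 1 and 2 of a
-- pyramid, or a sector of length 2 of a wheel. Otherwise the vertices around
-- one end of a long piece form an induced P4, and an interior vertex of a
-- further path (of a second long sector, for a wheel) is isolated from it.

module Submission where

open import Defs
open import Data.Nat using (ℕ; zero; suc; _+_; _≤_; _<_; z≤n; s≤s)
open import Data.Nat.Properties using (+-assoc; +-comm; +-suc; +-identityʳ; ≤-trans; m≤m+n)
open import Data.Nat.DivMod using (_%_; m%n<n; %-distribˡ-+; [m+n]%n≡m%n; m<n⇒m%n≡m; m%n%n≡m%n)
open import Data.Fin using (Fin; toℕ; _≟_)
open import Data.Fin.Patterns using (0F; 1F; 2F; 3F; 4F)
open import Data.Fin.Properties using (toℕ-fromℕ<; toℕ-injective; toℕ<n; all?)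
open import Data.Bool using (true; false)
import Data.Bool.Properties as Bool
open import Data.List using (List; []; _∷_; _++_; _∷ʳ_)
open import Data.List.Membership.Propositional using (_∈_; _∉_)
open import Data.List.Membership.Propositional.Properties using (∈-++⁻; ∈-++⁺ˡ; ∈-++⁺ʳ)
open import Data.List.Relation.Unary.Any using (here; there)
open import Data.List.Relation.Unary.AllPairs using ([]; _∷_)
import Data.List.Relation.Unary.All.Properties as All
open import Data.List.Relation.Unary.Unique.Propositional using (Unique)
open import Data.List.Relation.Unary.Unique.Propositional.Properties using (Unique[x∷xs]⇒x∉xs)
open import Data.Product using (∃-syntax; _×_; _,_; proj₁; proj₂)
open import Data.Sum using (_⊎_; inj₁; inj₂)
open import Data.Empty using (⊥; ⊥-elim)
open import Function.Bundles using (_⇔_; Equivalence)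
open import Relation.Binary.PropositionalEquality using (_≡_; _≢_; refl; sym; trans; cong; subst; ≢-sym; module ≡-Reasoning)
open import Relation.Nullary using (¬_; Dec)
open import Relation.Nullary.Decidable using (toWitness; _⊎-dec_; _→-dec_)

private variable
  A : Set
  a b u v w x y z : A
  t xs ys : List A

∈-∷ʳ⁻ : v ∈ xs ∷ʳ b → v ∈ xs ⊎ v ≡ b
∈-∷ʳ⁻ {xs = xs} v∈ with ∈-++⁻ xs v∈
... | inj₁ v∈xs = inj₁ v∈xs
... | inj₂ (here v≡b) = inj₂ v≡b

Unique-++⁻ˡ : ∀ xs → Unique (xs ++ ys) → Unique xs
Unique-++⁻ˡ [] _ = []
Unique-++⁻ˡ (x ∷ xs) (x∉ ∷ u) = All.++⁻ˡ xs x∉ ∷ Unique-++⁻ˡ xs u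

Unique-++⁻ʳ : ∀ xs → Unique (xs ++ ys) → Unique ys
Unique-++⁻ʳ [] u = u
Unique-++⁻ʳ (x ∷ xs) (_ ∷ u) = Unique-++⁻ʳ xs u

Unique-++⇒disjoint : ∀ xs → Unique (xs ++ ys) → v ∈ xs → v ∉ ys
Unique-++⇒disjoint (x ∷ xs) u (here refl) v∈ys = Unique[x∷xs]⇒x∉xs u (∈-++⁺ʳ xs v∈ys)
Unique-++⇒disjoint (x ∷ xs) (_ ∷ u) (there v∈xs) = Unique-++⇒disjoint xs u v∈xs

Consec⇒∈ : Consec t u v → u ∈ t × v ∈ t
Consec⇒∈ here = here refl , there (here refl)
Consec⇒∈ (there c) with Consec⇒∈ c
... | u∈ , v∈ = there u∈ , there v∈

PathEdge⇒∈ : PathEdge t u v → u ∈ t × v ∈ t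
PathEdge⇒∈ (inj₁ c) = Consec⇒∈ c
PathEdge⇒∈ (inj₂ c) with Consec⇒∈ c
... | v∈ , u∈ = u∈ , v∈

successor-of-head : a ∉ t → PathEdge (a ∷ t) a v → Consec (a ∷ t) a w → v ≡ w
successor-of-head a∉t (inj₁ here)      here      = refl
successor-of-head a∉t (inj₁ here)      (there c) = ⊥-elim (a∉t (proj₁ (Consec⇒∈ c)))
successor-of-head a∉t (inj₁ (there c)) _         = ⊥-elim (a∉t (proj₁ (Consec⇒∈ c)))
successor-of-head a∉t (inj₂ here)      _         = ⊥-elim (a∉t (here refl))
successor-of-head a∉t (inj₂ (there c)) _         = ⊥-elim (a∉t (proj₂ (Consec⇒∈ c)))

data Beginning (a b : A) (m : List A) : Set where
  short : x ∈ m → Consec (a ∷ m ∷ʳ b) a x → Consec (a ∷ m ∷ʳ b) x b → Beginning a b m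
  long  : x ∈ m → y ∈ m → Consec (a ∷ m ∷ʳ b) a x → Consec (a ∷ m ∷ʳ b) x y → Beginning a b m

beginning : ∀ m → NonEmpty m → Beginning a b m
beginning (x ∷ [])    _ = short (here refl) here (there here)
beginning (x ∷ y ∷ m) _ = long (here refl) (there (here refl)) here (there here)

empty-or-beginning : ∀ m → m ≡ [] ⊎ Beginning a b m
empty-or-beginning []      = inj₁ refl
empty-or-beginning (x ∷ m) = inj₂ (beginning (x ∷ m) (s≤s z≤n))

first-interior : ∀ {m} → Beginning a b m → ∃[ x ] x ∈ m × Consec (a ∷ m ∷ʳ b) a x
first-interior (short x∈ c _)  = _ , x∈ , c
first-interior (long x∈ _ c _) = _ , x∈ , c

last-interior : ∀ m → x ∈ m → ∃[ u ] u ∈ m × Consec (m ∷ʳ b) u b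
last-interior (z ∷ [])     _ = z , here refl , here
last-interior (z ∷ z′ ∷ m) _ with last-interior (z′ ∷ m) (here refl)
... | u , u∈ , c = u , there u∈ , there c

successor-of-apex : ∀ {m} → m ≡ [] ⊎ Beginning a b m → ∃[ c ] c ∈ m ∷ʳ b × Consec (a ∷ m ∷ʳ b) a c
successor-of-apex (inj₁ refl) = _ , here refl , here
successor-of-apex (inj₂ s) with first-interior s
... | x , x∈ , c = x , ∈-++⁺ˡ x∈ , c

consec-empty : ∀ {m} → m ≡ [] → Consec (a ∷ m ∷ʳ b) a b
consec-empty refl = here

triple : A → A → A → Fin 3 → A
triple p _ _ 0F = p
triple _ q _ 1F = q
triple _ _ r 2F = r

∈-blocks : (L : Fin 3 → List A) → ∀ i → v ∈ L i → v ∈ L 0F ++ L 1F ++ L 2F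
∈-blocks L 0F v∈ = ∈-++⁺ˡ v∈
∈-blocks L 1F v∈ = ∈-++⁺ʳ (L 0F) (∈-++⁺ˡ v∈)
∈-blocks L 2F v∈ = ∈-++⁺ʳ (L 0F) (∈-++⁺ʳ (L 1F) v∈)

module _ (L : Fin 3 → List A) (unique : Unique (L 0F ++ L 1F ++ L 2F)) where

  block-unique : ∀ i → Unique (L i)
  block-unique 0F = Unique-++⁻ˡ (L 0F) unique
  block-unique 1F = Unique-++⁻ˡ (L 1F) (Unique-++⁻ʳ (L 0F) unique)
  block-unique 2F = Unique-++⁻ʳ (L 1F) (Unique-++⁻ʳ (L 0F) unique)

  private
    disjoint₀ : v ∈ L 0F → v ∉ L 1F ++ L 2F
    disjoint₀ = Unique-++⇒disjoint (L 0F) unique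

    disjoint₁ : v ∈ L 1F → v ∉ L 2F
    disjoint₁ = Unique-++⇒disjoint (L 1F) (Unique-++⁻ʳ (L 0F) unique)

  block-index : ∀ {s i} → v ∈ L s → v ∈ L i → i ≡ s
  block-index {s = 0F} {0F} _   _   = refl
  block-index {s = 0F} {1F} v∈₀ v∈₁ = ⊥-elim (disjoint₀ v∈₀ (∈-++⁺ˡ v∈₁))
  block-index {s = 0F} {2F} v∈₀ v∈₂ = ⊥-elim (disjoint₀ v∈₀ (∈-++⁺ʳ (L 1F) v∈₂))
  block-index {s = 1F} {0F} v∈₁ v∈₀ = ⊥-elim (disjoint₀ v∈₀ (∈-++⁺ˡ v∈₁))
  block-index {s = 1F} {1F} _   _   = refl
  block-index {s = 1F} {2F} v∈₁ v∈₂ = ⊥-elim (disjoint₁ v∈₁ v∈₂)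
  block-index {s = 2F} {0F} v∈₂ v∈₀ = ⊥-elim (disjoint₀ v∈₀ (∈-++⁺ʳ (L 1F) v∈₂))
  block-index {s = 2F} {1F} v∈₂ v∈₁ = ⊥-elim (disjoint₁ v∈₁ v∈₂)
  block-index {s = 2F} {2F} _   _   = refl

Corner : (Fin 3 → A) → A → Set
Corner f u = ∃[ p ] u ≡ f p

InTriangle⇒corners : (f : Fin 3 → A) → InTriangle (f 0F) (f 1F) (f 2F) u v → Corner f u × Corner f v
InTriangle⇒corners f ((u∈ , v∈) , _) = corner u∈ , corner v∈
  where
  corner : w ≡ f 0F ⊎ w ≡ f 1F ⊎ w ≡ f 2F → Corner f w
  corner (inj₁ w≡)        = 0F , w≡
  corner (inj₂ (inj₁ w≡)) = 1F , w≡
  corner (inj₂ (inj₂ w≡)) = 2F , w≡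

corners⇒InTriangle : (f : Fin 3 → A) → ∀ {p q} → f p ≢ f q → InTriangle (f 0F) (f 1F) (f 2F) (f p) (f q)
corners⇒InTriangle f f≢ = (listed _ , listed _) , f≢
  where
  listed : ∀ p → f p ≡ f 0F ⊎ f p ≡ f 1F ⊎ f p ≡ f 2F
  listed 0F = inj₁ refl
  listed 1F = inj₂ (inj₁ refl)
  listed 2F = inj₂ (inj₂ refl)

AtLeastTwo : Set → Set → Set → Set
AtLeastTwo P Q R = (P × Q) ⊎ (P × R) ⊎ (Q × R)

AtLeastTwo-rotate : ∀ {P Q R} → AtLeastTwo P Q R → AtLeastTwo Q R P
AtLeastTwo-rotate (inj₁ (p , q))        = inj₂ (inj₁ (q , p))
AtLeastTwo-rotate (inj₂ (inj₁ (p , r))) = inj₂ (inj₂ (r , p))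
AtLeastTwo-rotate (inj₂ (inj₂ qr))      = inj₁ qr

AtLeastTwo⇒¬¬ : ∀ {P Q R} → AtLeastTwo P Q R → ¬ P → ¬ Q → ⊥
AtLeastTwo⇒¬¬ (inj₁ (p , _))        ¬p _  = ¬p p
AtLeastTwo⇒¬¬ (inj₂ (inj₁ (p , _))) ¬p _  = ¬p p
AtLeastTwo⇒¬¬ (inj₂ (inj₂ (q , _))) _  ¬q = ¬q q

empty⇒¬NonEmpty : ∀ {m : List A} → m ≡ [] → ¬ NonEmpty m
empty⇒¬NonEmpty refl ()

module _ {G : Graph} (simple : SimpleGraph G) where

  adjacent-sym : E G u v → E G v u
  adjacent-sym {u} {v} e = trans (proj₁ simple v u) e

  nonadjacent-sym : ¬ E G u v → ¬ E G v u
  nonadjacent-sym ¬e e = ¬e (adjacent-sym e)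

  adjacent⇒≢ : E G u v → u ≢ v
  adjacent⇒≢ {u} e refl with trans (sym (proj₂ simple u)) e
  ... | ()

SameNeighbourhood : (F : Graph) → V F → V F → Set
SameNeighbourhood F i j = ∀ k → adj F i k ≡ adj F j k

adjacency-preserving⇒induced : ∀ {G F} (f : V F → V G) → (∀ i j → adj F i j ≡ adj G (f i) (f j)) →
          (∀ {i j} → SameNeighbourhood F i j → f i ≡ f j → i ≡ j) → ContainsInduced G F
adjacency-preserving⇒induced {G} f preserves separates = f , injective , preserves
  where
  injective : ∀ i j → f i ≡ f j → i ≡ j
  injective i j fi≡fj = separates same fi≡fj
    where
    same : SameNeighbourhood _ i j
    same k = trans (preserves i k) (trans (cong (λ z → adj G z (f k)) fi≡fj) (sym (preserves j k)))

P4+P1-twinFree : ∀ {i j} → SameNeighbourhood P4+P1 i j → i ≡ j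
P4+P1-twinFree {i} {j} = toWitness {a? = decision} _ i j
  where
  decision : Dec (∀ i j → SameNeighbourhood P4+P1 i j → i ≡ j)
  decision = all? λ i → all? λ j →
    all? (λ k → adj P4+P1 i k Bool.≟ adj P4+P1 j k) →-dec i ≟ j

opposite : Fin 4 → Fin 4
opposite 0F = 2F
opposite 1F = 3F
opposite 2F = 0F
opposite 3F = 1F

C4-twins : ∀ {i j} → SameNeighbourhood C4 i j → i ≡ j ⊎ j ≡ opposite i
C4-twins {i} {j} = toWitness {a? = decision} _ i j
  where
  decision : Dec (∀ i j → SameNeighbourhood C4 i j → i ≡ j ⊎ j ≡ opposite i)
  decision = all? λ i → all? λ j →
    all? (λ k → adj C4 i k Bool.≟ adj C4 j k) →-dec (i ≟ j ⊎-dec j ≟ opposite i)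

module _ {G : Graph} (simple : SimpleGraph G) where

  private
    edge : E G u v → true ≡ adj G u v
    edge = sym

    edge′ : E G u v → true ≡ adj G v u
    edge′ e = sym (adjacent-sym simple e)

    non-edge : ¬ E G u v → false ≡ adj G u v
    non-edge {u} {v} ¬e with adj G u v
    ... | true  = ⊥-elim (¬e refl)
    ... | false = refl

    non-edge′ : ¬ E G u v → false ≡ adj G v u
    non-edge′ ¬e = non-edge (nonadjacent-sym simple ¬e)

    loop : ∀ u → false ≡ adj G u u
    loop u = sym (proj₂ simple u)

  induced-P4+P1 : (v₀ v₁ v₂ v₃ w : V G) →
                  E G v₀ v₁ → E G v₁ v₂ → E G v₂ v₃ →
                  ¬ E G v₀ v₂ → ¬ E G v₀ v₃ → ¬ E G v₁ v₃ →
                  ¬ E G w v₀ → ¬ E G w v₁ → ¬ E G w v₂ → ¬ E G w v₃ →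
                  ContainsInduced G P4+P1
  induced-P4+P1 v₀ v₁ v₂ v₃ w e₀₁ e₁₂ e₂₃ n₀₂ n₀₃ n₁₃ n₀ n₁ n₂ n₃ =
    adjacency-preserving⇒induced {G} f preserves λ same _ → P4+P1-twinFree same
    where
    f : Fin 5 → V G
    f 0F = v₀
    f 1F = v₁
    f 2F = v₂
    f 3F = v₃
    f 4F = w

    preserves : ∀ i j → adj P4+P1 i j ≡ adj G (f i) (f j)
    preserves 0F 0F = loop v₀
    preserves 0F 1F = edge e₀₁
    preserves 0F 2F = non-edge n₀₂
    preserves 0F 3F = non-edge n₀₃
    preserves 0F 4F = non-edge′ n₀
    preserves 1F 0F = edge′ e₀₁
    preserves 1F 1F = loop v₁
    preserves 1F 2F = edge e₁₂
    preserves 1F 3F = non-edge n₁₃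
    preserves 1F 4F = non-edge′ n₁
    preserves 2F 0F = non-edge′ n₀₂
    preserves 2F 1F = edge′ e₁₂
    preserves 2F 2F = loop v₂
    preserves 2F 3F = edge e₂₃
    preserves 2F 4F = non-edge′ n₂
    preserves 3F 0F = non-edge′ n₀₃
    preserves 3F 1F = non-edge′ n₁₃
    preserves 3F 2F = edge′ e₂₃
    preserves 3F 3F = loop v₃
    preserves 3F 4F = non-edge′ n₃
    preserves 4F 0F = non-edge n₀
    preserves 4F 1F = non-edge n₁
    preserves 4F 2F = non-edge n₂
    preserves 4F 3F = non-edge n₃
    preserves 4F 4F = loop w

  induced-C4 : (v₀ v₁ v₂ v₃ : V G) →
               E G v₀ v₁ → E G v₁ v₂ → E G v₂ v₃ → E G v₃ v₀ →
               ¬ E G v₀ v₂ → ¬ E G v₁ v₃ → v₀ ≢ v₂ → v₁ ≢ v₃ →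
               ContainsInduced G C4
  induced-C4 v₀ v₁ v₂ v₃ e₀₁ e₁₂ e₂₃ e₃₀ n₀₂ n₁₃ v₀≢v₂ v₁≢v₃ =
    adjacency-preserving⇒induced {G} f preserves separates
    where
    f : Fin 4 → V G
    f 0F = v₀
    f 1F = v₁
    f 2F = v₂
    f 3F = v₃

    preserves : ∀ i j → adj C4 i j ≡ adj G (f i) (f j)
    preserves 0F 0F = loop v₀
    preserves 0F 1F = edge e₀₁
    preserves 0F 2F = non-edge n₀₂
    preserves 0F 3F = edge′ e₃₀
    preserves 1F 0F = edge′ e₀₁
    preserves 1F 1F = loop v₁
    preserves 1F 2F = edge e₁₂
    preserves 1F 3F = non-edge n₁₃
    preserves 2F 0F = non-edge′ n₀₂
    preserves 2F 1F = edge′ e₁₂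
    preserves 2F 2F = loop v₂
    preserves 2F 3F = edge e₂₃
    preserves 3F 0F = edge e₃₀
    preserves 3F 1F = non-edge′ n₁₃
    preserves 3F 2F = edge′ e₂₃
    preserves 3F 3F = loop v₃

    opposite-distinct : ∀ i → f i ≢ f (opposite i)
    opposite-distinct 0F = v₀≢v₂
    opposite-distinct 1F = v₁≢v₃
    opposite-distinct 2F = λ eq → v₀≢v₂ (sym eq)
    opposite-distinct 3F = λ eq → v₁≢v₃ (sym eq)

    separates : ∀ {i j} → SameNeighbourhood C4 i j → f i ≡ f j → i ≡ j
    separates same fi≡fj with C4-twins same
    ... | inj₁ i≡j  = i≡j
    ... | inj₂ refl = ⊥-elim (opposite-distinct _ fi≡fj)

-- Extra edges: the triangle edges of a prism or pyramid, none for a theta.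
module ThreePaths {G : Graph} (P : Fin 3 → List (V G)) (Extra : V G → V G → Set)
  (adjacent⇒ : ∀ {u v} → E G u v → (∃[ i ] PathEdge (P i) u v) ⊎ Extra u v)
  (path-edge⇒adjacent : ∀ {i u v} → PathEdge (P i) u v → E G u v) where

  consec⇒adjacent : ∀ {i} → Consec (P i) u v → E G u v
  consec⇒adjacent c = path-edge⇒adjacent (inj₁ c)

  consec⇒adjacent′ : ∀ {i} → Consec (P i) u v → E G v u
  consec⇒adjacent′ c = path-edge⇒adjacent (inj₂ c)

  OnlyOn : Fin 3 → V G → Set
  OnlyOn s v = ∀ {i} → v ∈ P i → i ≡ s

  adjacent-on-path : ∀ {s} → OnlyOn s v → ¬ Extra u v → E G u v → PathEdge (P s) u v
  adjacent-on-path only ¬extra e with adjacent⇒ e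
  ... | inj₂ extra = ⊥-elim (¬extra extra)
  ... | inj₁ (i , pe) with only (proj₂ (PathEdge⇒∈ pe))
  ...   | refl = pe

  apart⇒nonadjacent : ∀ {s t} → OnlyOn s u → OnlyOn t v → s ≢ t → ¬ Extra u v → ¬ E G u v
  apart⇒nonadjacent only-u only-v s≢t ¬extra e =
    s≢t (sym (only-u (proj₁ (PathEdge⇒∈ (adjacent-on-path only-v ¬extra e)))))

  apart⇒distinct : ∀ {s t} → OnlyOn s u → v ∈ P t → s ≢ t → u ≢ v
  apart⇒distinct only-u v∈ s≢t refl = s≢t (sym (only-u v∈))

module ThreePathsFrom {G : Graph} (simple : SimpleGraph G) (a : V G) (T : Fin 3 → List (V G))
  (Extra : V G → V G → Set)
  (adjacent⇒ : ∀ {u v} → E G u v → (∃[ i ] PathEdge (a ∷ T i) u v) ⊎ Extra u v)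
  (path-edge⇒adjacent : ∀ {i u v} → PathEdge (a ∷ T i) u v → E G u v)
  (a∉T : ∀ i → a ∉ T i) where

  open ThreePaths (λ i → a ∷ T i) Extra adjacent⇒ path-edge⇒adjacent public

  apex-neighbour : ∀ {s} → OnlyOn s v → ¬ Extra a v → E G a v → Consec (a ∷ T s) a w → v ≡ w
  apex-neighbour only ¬extra e = successor-of-head (a∉T _) (adjacent-on-path only ¬extra e)

  apex-nonadjacent : ∀ {s} → OnlyOn s v → ¬ Extra a v →
                     Consec (a ∷ T s) a w → Consec (a ∷ T s) w v → ¬ E G a v
  apex-nonadjacent only ¬extra c₁ c₂ e with apex-neighbour only ¬extra e c₁
  ... | refl = adjacent⇒≢ simple (consec⇒adjacent c₂) refl

-- Thetas

module Theta {G : Graph} (simple : SimpleGraph G) (a b : V G) (m : Fin 3 → List (V G))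
  (unique : Unique (a ∷ b ∷ m 0F ++ m 1F ++ m 2F))
  (adjacency : ∀ u v → E G u v ⇔ (PathEdge (a ∷ m 0F ∷ʳ b) u v ⊎ PathEdge (a ∷ m 1F ∷ʳ b) u v
                                   ⊎ PathEdge (a ∷ m 2F ∷ʳ b) u v))
  (nonempty₀ : NonEmpty (m 0F)) (nonempty₁ : NonEmpty (m 1F)) (nonempty₂ : NonEmpty (m 2F)) where

  P : Fin 3 → List (V G)
  P i = a ∷ m i ∷ʳ b

  private
    nonempty : ∀ i → NonEmpty (m i)
    nonempty 0F = nonempty₀
    nonempty 1F = nonempty₁
    nonempty 2F = nonempty₂

    adjacent⇒ : E G u v → (∃[ i ] PathEdge (P i) u v) ⊎ ⊥
    adjacent⇒ e with Equivalence.to (adjacency _ _) e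
    ... | inj₁ pe        = inj₁ (0F , pe)
    ... | inj₂ (inj₁ pe) = inj₁ (1F , pe)
    ... | inj₂ (inj₂ pe) = inj₁ (2F , pe)

    path-edge⇒adjacent : ∀ {i} → PathEdge (P i) u v → E G u v
    path-edge⇒adjacent {i = 0F} pe = Equivalence.from (adjacency _ _) (inj₁ pe)
    path-edge⇒adjacent {i = 1F} pe = Equivalence.from (adjacency _ _) (inj₂ (inj₁ pe))
    path-edge⇒adjacent {i = 2F} pe = Equivalence.from (adjacency _ _) (inj₂ (inj₂ pe))

    a≢b : a ≢ b
    a≢b a≡b = Unique[x∷xs]⇒x∉xs unique (here a≡b)

    a∉m : ∀ {i} → a ∉ m i
    a∉m a∈ = Unique[x∷xs]⇒x∉xs unique (there (∈-blocks m _ a∈))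

    b∉m : ∀ {i} → b ∉ m i
    b∉m b∈ = Unique[x∷xs]⇒x∉xs (Unique-++⁻ʳ (a ∷ []) unique) (∈-blocks m _ b∈)

    a∉tail : ∀ i → a ∉ m i ∷ʳ b
    a∉tail i a∈ with ∈-∷ʳ⁻ a∈
    ... | inj₁ a∈m = a∉m a∈m
    ... | inj₂ a≡b = a≢b a≡b

  open ThreePathsFrom simple a (λ i → m i ∷ʳ b) (λ _ _ → ⊥) adjacent⇒ path-edge⇒adjacent a∉tail

  interior-only : ∀ {s} → v ∈ m s → OnlyOn s v
  interior-only v∈ (here refl) = ⊥-elim (a∉m v∈)
  interior-only v∈ (there v∈′) with ∈-∷ʳ⁻ v∈′
  ... | inj₁ v∈m = block-index m (Unique-++⁻ʳ (a ∷ b ∷ []) unique) v∈ v∈m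
  ... | inj₂ refl = ⊥-elim (b∉m v∈)

  interior-nonadjacent : ∀ {s t} → s ≢ t → u ∈ m s → v ∈ m t → ¬ E G u v
  interior-nonadjacent s≢t u∈ v∈ = apart⇒nonadjacent (interior-only u∈) (interior-only v∈) s≢t (λ ())

  -- a is adjacent only to the first interior vertex of each path, and no
  -- path is empty.
  a-b-nonadjacent : ¬ E G a b
  a-b-nonadjacent e with adjacent⇒ e
  ... | inj₁ (i , pe) with first-interior (beginning {a = a} {b = b} (m i) (nonempty i))
  ...   | x , x∈ , c with successor-of-head (a∉tail i) pe c
  ...     | refl = b∉m x∈

  two-short⇒C4 : ∀ i j → i ≢ j →
                 x ∈ m i → Consec (P i) a x → Consec (P i) x b →
                 y ∈ m j → Consec (P j) a y → Consec (P j) y b → ContainsInduced G C4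
  two-short⇒C4 _ _ i≢j x∈ ax xb y∈ ay yb =
    induced-C4 simple a _ b _ (consec⇒adjacent ax) (consec⇒adjacent xb)
      (consec⇒adjacent′ yb) (consec⇒adjacent′ ay)
      a-b-nonadjacent (interior-nonadjacent i≢j x∈ y∈)
      a≢b (apart⇒distinct (interior-only x∈) (proj₂ (Consec⇒∈ ay)) i≢j)

  two-long⇒P4+P1 : ∀ i j k → i ≢ j → i ≢ k → j ≢ k →
                   x ∈ m i → y ∈ m i → Consec (P i) a x → Consec (P i) x y →
                   z ∈ m j → Consec (P j) a w → Consec (P j) w z →
                   Beginning a b (m k) → ContainsInduced G P4+P1
  two-long⇒P4+P1 _ _ _ i≢j i≢k j≢k x∈ y∈ ax xy z∈ aw wz start-k
    with first-interior start-k
  ... | c , c∈ , ac =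
    induced-P4+P1 simple c a _ _ _ (consec⇒adjacent′ ac) (consec⇒adjacent ax) (consec⇒adjacent xy)
      (interior-nonadjacent (≢-sym i≢k) c∈ x∈) (interior-nonadjacent (≢-sym i≢k) c∈ y∈)
      (apex-nonadjacent (interior-only y∈) (λ ()) ax xy)
      (interior-nonadjacent j≢k z∈ c∈)
      (nonadjacent-sym simple (apex-nonadjacent (interior-only z∈) (λ ()) aw wz))
      (interior-nonadjacent (≢-sym i≢j) z∈ x∈) (interior-nonadjacent (≢-sym i≢j) z∈ y∈)

  contains : ContainsInduced G P4+P1 ⊎ ContainsInduced G C4
  contains = cases (start 0F) (start 1F) (start 2F)
    where
    start : ∀ i → Beginning a b (m i)
    start i = beginning (m i) (nonempty i)

    cases : Beginning a b (m 0F) → Beginning a b (m 1F) → Beginning a b (m 2F) →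
            ContainsInduced G P4+P1 ⊎ ContainsInduced G C4
    cases (short x∈ ax xb) (short y∈ ay yb) _ =
      inj₂ (two-short⇒C4 0F 1F (λ ()) x∈ ax xb y∈ ay yb)
    cases (short x∈ ax xb) (long _ _ _ _) (short y∈ ay yb) =
      inj₂ (two-short⇒C4 0F 2F (λ ()) x∈ ax xb y∈ ay yb)
    cases (long _ _ _ _) (short x∈ ax xb) (short y∈ ay yb) =
      inj₂ (two-short⇒C4 1F 2F (λ ()) x∈ ax xb y∈ ay yb)
    cases (long x∈ y∈ ax xy) (long _ z∈ aw wz) start₂ =
      inj₁ (two-long⇒P4+P1 0F 1F 2F (λ ()) (λ ()) (λ ()) x∈ y∈ ax xy z∈ aw wz start₂)
    cases (long x∈ y∈ ax xy) start₁@(short _ _ _) (long _ z∈ aw wz) =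
      inj₁ (two-long⇒P4+P1 0F 2F 1F (λ ()) (λ ()) (λ ()) x∈ y∈ ax xy z∈ aw wz start₁)
    cases start₀@(short _ _ _) (long x∈ y∈ ax xy) (long _ z∈ aw wz) =
      inj₁ (two-long⇒P4+P1 1F 2F 0F (λ ()) (λ ()) (λ ()) x∈ y∈ ax xy z∈ aw wz start₀)

-- Prisms

module Prism {G : Graph} (simple : SimpleGraph G) (as bs : Fin 3 → V G) (m : Fin 3 → List (V G))
  (unique : Unique ((as 0F ∷ m 0F ∷ʳ bs 0F) ++ (as 1F ∷ m 1F ∷ʳ bs 1F) ++ (as 2F ∷ m 2F ∷ʳ bs 2F)))
  (adjacency : ∀ u v → E G u v ⇔
     (PathEdge (as 0F ∷ m 0F ∷ʳ bs 0F) u v ⊎ PathEdge (as 1F ∷ m 1F ∷ʳ bs 1F) u v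
      ⊎ PathEdge (as 2F ∷ m 2F ∷ʳ bs 2F) u v
      ⊎ InTriangle (as 0F) (as 1F) (as 2F) u v ⊎ InTriangle (bs 0F) (bs 1F) (bs 2F) u v)) where

  P : Fin 3 → List (V G)
  P i = as i ∷ m i ∷ʳ bs i

  Extra : V G → V G → Set
  Extra u v = InTriangle (as 0F) (as 1F) (as 2F) u v ⊎ InTriangle (bs 0F) (bs 1F) (bs 2F) u v

  private
    adjacent⇒ : E G u v → (∃[ i ] PathEdge (P i) u v) ⊎ Extra u v
    adjacent⇒ e with Equivalence.to (adjacency _ _) e
    ... | inj₁ pe               = inj₁ (0F , pe)
    ... | inj₂ (inj₁ pe)        = inj₁ (1F , pe)
    ... | inj₂ (inj₂ (inj₁ pe)) = inj₁ (2F , pe)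
    ... | inj₂ (inj₂ (inj₂ tri)) = inj₂ tri

    path-edge⇒adjacent : ∀ {i} → PathEdge (P i) u v → E G u v
    path-edge⇒adjacent {i = 0F} pe = Equivalence.from (adjacency _ _) (inj₁ pe)
    path-edge⇒adjacent {i = 1F} pe = Equivalence.from (adjacency _ _) (inj₂ (inj₁ pe))
    path-edge⇒adjacent {i = 2F} pe = Equivalence.from (adjacency _ _) (inj₂ (inj₂ (inj₁ pe)))

  open ThreePaths P Extra adjacent⇒ path-edge⇒adjacent

  on-path-only : ∀ {s} → v ∈ P s → OnlyOn s v
  on-path-only v∈ v∈′ = block-index P unique v∈ v∈′

  bottom∈ : ∀ s → bs s ∈ P s
  bottom∈ s = there (∈-++⁺ʳ (m s) (here refl))

  tail-not-top : ∀ {s} → v ∈ m s ∷ʳ bs s → ¬ Corner as v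
  tail-not-top {s = s} v∈ (p , refl) with on-path-only (there v∈) (here refl)
  ... | refl = Unique[x∷xs]⇒x∉xs (block-unique P unique s) v∈

  interior-not-bottom : ∀ {s} → v ∈ m s → ¬ Corner bs v
  interior-not-bottom {s = s} v∈ (p , refl) with on-path-only (there (∈-++⁺ˡ v∈)) (bottom∈ p)
  ... | refl =
    Unique-++⇒disjoint (m s) (Unique-++⁻ʳ (as s ∷ []) (block-unique P unique s)) v∈ (here refl)

  top-not-bottom : ∀ s → ¬ Corner bs (as s)
  top-not-bottom s (p , eq) with on-path-only (here refl) (subst (_∈ P p) (sym eq) (bottom∈ p))
  ... | refl = tail-not-top (∈-++⁺ʳ (m s) (here refl)) (s , sym eq)

  off-triangles⇒nonadjacent : ∀ {s t} → s ≢ t → u ∈ P s → v ∈ P t →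
                              (¬ Corner as u ⊎ ¬ Corner as v) → (¬ Corner bs u ⊎ ¬ Corner bs v) →
                              ¬ E G u v
  off-triangles⇒nonadjacent s≢t u∈ v∈ off-top off-bottom =
    apart⇒nonadjacent (on-path-only u∈) (on-path-only v∈) s≢t not-extra
    where
    not-both : ∀ {Q R : Set} → ¬ Q ⊎ ¬ R → Q × R → ⊥
    not-both (inj₁ ¬q) (q , _) = ¬q q
    not-both (inj₂ ¬r) (_ , r) = ¬r r

    not-extra : ¬ Extra _ _
    not-extra (inj₁ tri) = not-both off-top (InTriangle⇒corners as tri)
    not-extra (inj₂ tri) = not-both off-bottom (InTriangle⇒corners bs tri)

  interior-nonadjacent : ∀ {s t} → s ≢ t → u ∈ m s → v ∈ P t → ¬ E G u v
  interior-nonadjacent s≢t u∈ v∈ =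
    off-triangles⇒nonadjacent s≢t (there (∈-++⁺ˡ u∈)) v∈
      (inj₁ (tail-not-top (∈-++⁺ˡ u∈))) (inj₁ (interior-not-bottom u∈))

  top-adjacent : ∀ {s t} → s ≢ t → E G (as s) (as t)
  top-adjacent s≢t = Equivalence.from (adjacency _ _) (inj₂ (inj₂ (inj₂ (inj₁
    (corners⇒InTriangle as (apart⇒distinct (on-path-only (here refl)) (here refl) s≢t))))))

  bottom-adjacent : ∀ {s t} → s ≢ t → E G (bs s) (bs t)
  bottom-adjacent {t = t} s≢t = Equivalence.from (adjacency _ _) (inj₂ (inj₂ (inj₂ (inj₂
    (corners⇒InTriangle bs (apart⇒distinct (on-path-only (bottom∈ _)) (bottom∈ t) s≢t))))))

  top-bottom-nonadjacent : ∀ {s t} → s ≢ t → ¬ E G (as s) (bs t)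
  top-bottom-nonadjacent {t = t} s≢t =
    off-triangles⇒nonadjacent s≢t (here refl) (bottom∈ t)
      (inj₂ (tail-not-top (∈-++⁺ʳ (m t) (here refl)))) (inj₁ (top-not-bottom _))

  two-rungs⇒C4 : ∀ j k → j ≢ k → m j ≡ [] → m k ≡ [] → ContainsInduced G C4
  two-rungs⇒C4 j k j≢k m-j≡[] m-k≡[] =
    induced-C4 simple (as j) (as k) (bs k) (bs j)
      (top-adjacent j≢k) (consec⇒adjacent (consec-empty m-k≡[])) (bottom-adjacent (≢-sym j≢k))
      (consec⇒adjacent′ (consec-empty m-j≡[]))
      (top-bottom-nonadjacent j≢k) (top-bottom-nonadjacent (≢-sym j≢k))
      (apart⇒distinct (on-path-only (here refl)) (bottom∈ k) j≢k)
      (apart⇒distinct (on-path-only (here refl)) (bottom∈ j) (≢-sym j≢k))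

  two-nonempty⇒P4+P1 : ∀ i j k → i ≢ j → i ≢ k → j ≢ k →
                       Beginning (as i) (bs i) (m i) → Beginning (as j) (bs j) (m j) →
                       m k ≡ [] ⊎ Beginning (as k) (bs k) (m k) → ContainsInduced G P4+P1
  two-nonempty⇒P4+P1 i j k i≢j i≢k j≢k start-i start-j start-k
    with first-interior start-i | first-interior start-j | successor-of-apex start-k
  ... | x , x∈ , ax | y , y∈ , _ | c , c∈ , ac =
    induced-P4+P1 simple x (as i) (as k) c y
      (consec⇒adjacent′ ax) (top-adjacent i≢k) (consec⇒adjacent ac)
      (interior-nonadjacent i≢k x∈ (here refl)) (interior-nonadjacent i≢k x∈ (there c∈))
      (off-triangles⇒nonadjacent i≢k (here refl) (there c∈)
         (inj₂ (tail-not-top c∈)) (inj₁ (top-not-bottom i)))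
      (interior-nonadjacent (≢-sym i≢j) y∈ (there (∈-++⁺ˡ x∈)))
      (interior-nonadjacent (≢-sym i≢j) y∈ (here refl))
      (interior-nonadjacent j≢k y∈ (here refl))
      (interior-nonadjacent j≢k y∈ (there c∈))

  contains : ContainsInduced G P4+P1 ⊎ ContainsInduced G C4
  contains = cases (shape 0F) (shape 1F) (shape 2F)
    where
    Shape : Fin 3 → Set
    Shape i = m i ≡ [] ⊎ Beginning (as i) (bs i) (m i)

    shape : ∀ i → Shape i
    shape i = empty-or-beginning (m i)

    cases : Shape 0F → Shape 1F → Shape 2F → ContainsInduced G P4+P1 ⊎ ContainsInduced G C4
    cases (inj₁ e₀) (inj₁ e₁) _         = inj₂ (two-rungs⇒C4 0F 1F (λ ()) e₀ e₁)
    cases (inj₁ e₀) (inj₂ _)  (inj₁ e₂) = inj₂ (two-rungs⇒C4 0F 2F (λ ()) e₀ e₂)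
    cases (inj₂ _)  (inj₁ e₁) (inj₁ e₂) = inj₂ (two-rungs⇒C4 1F 2F (λ ()) e₁ e₂)
    cases (inj₂ s₀) (inj₂ s₁) s₂ =
      inj₁ (two-nonempty⇒P4+P1 0F 1F 2F (λ ()) (λ ()) (λ ()) s₀ s₁ s₂)
    cases (inj₂ s₀) s₁@(inj₁ _) (inj₂ s₂) =
      inj₁ (two-nonempty⇒P4+P1 0F 2F 1F (λ ()) (λ ()) (λ ()) s₀ s₂ s₁)
    cases s₀@(inj₁ _) (inj₂ s₁) (inj₂ s₂) =
      inj₁ (two-nonempty⇒P4+P1 1F 2F 0F (λ ()) (λ ()) (λ ()) s₁ s₂ s₀)

-- Pyramids

module Pyramid {G : Graph} (simple : SimpleGraph G) (a : V G) (bs : Fin 3 → V G) (m : Fin 3 → List (V G))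
  (unique : Unique (a ∷ (m 0F ∷ʳ bs 0F) ++ (m 1F ∷ʳ bs 1F) ++ (m 2F ∷ʳ bs 2F)))
  (adjacency : ∀ u v → E G u v ⇔
     (PathEdge (a ∷ m 0F ∷ʳ bs 0F) u v ⊎ PathEdge (a ∷ m 1F ∷ʳ bs 1F) u v
      ⊎ PathEdge (a ∷ m 2F ∷ʳ bs 2F) u v ⊎ InTriangle (bs 0F) (bs 1F) (bs 2F) u v))
  (two-nonempty : AtLeastTwo (NonEmpty (m 0F)) (NonEmpty (m 1F)) (NonEmpty (m 2F))) where

  T : Fin 3 → List (V G)
  T i = m i ∷ʳ bs i

  Extra : V G → V G → Set
  Extra = InTriangle (bs 0F) (bs 1F) (bs 2F)

  private
    adjacent⇒ : E G u v → (∃[ i ] PathEdge (a ∷ T i) u v) ⊎ Extra u v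
    adjacent⇒ e with Equivalence.to (adjacency _ _) e
    ... | inj₁ pe               = inj₁ (0F , pe)
    ... | inj₂ (inj₁ pe)        = inj₁ (1F , pe)
    ... | inj₂ (inj₂ (inj₁ pe)) = inj₁ (2F , pe)
    ... | inj₂ (inj₂ (inj₂ tri)) = inj₂ tri

    path-edge⇒adjacent : ∀ {i} → PathEdge (a ∷ T i) u v → E G u v
    path-edge⇒adjacent {i = 0F} pe = Equivalence.from (adjacency _ _) (inj₁ pe)
    path-edge⇒adjacent {i = 1F} pe = Equivalence.from (adjacency _ _) (inj₂ (inj₁ pe))
    path-edge⇒adjacent {i = 2F} pe = Equivalence.from (adjacency _ _) (inj₂ (inj₂ (inj₁ pe)))

    a∉T : ∀ i → a ∉ T i
    a∉T i a∈ = Unique[x∷xs]⇒x∉xs unique (∈-blocks T i a∈)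

    tails-unique : Unique (T 0F ++ T 1F ++ T 2F)
    tails-unique = Unique-++⁻ʳ (a ∷ []) unique

  open ThreePathsFrom simple a T Extra adjacent⇒ path-edge⇒adjacent a∉T

  tail-only : ∀ {s} → v ∈ T s → OnlyOn s v
  tail-only v∈ (here refl) = ⊥-elim (a∉T _ v∈)
  tail-only v∈ (there v∈′) = block-index T tails-unique v∈ v∈′

  bottom∈ : ∀ s → bs s ∈ T s
  bottom∈ s = ∈-++⁺ʳ (m s) (here refl)

  interior-not-bottom : ∀ {s} → v ∈ m s → ¬ Corner bs v
  interior-not-bottom {s = s} v∈ (p , refl) with tail-only (∈-++⁺ˡ v∈) (there (bottom∈ p))
  ... | refl = Unique-++⇒disjoint (m s) (block-unique T tails-unique s) v∈ (here refl)

  apex-not-bottom : ¬ Corner bs a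
  apex-not-bottom (p , refl) = a∉T p (bottom∈ p)

  not-extra : ¬ Corner bs u → ¬ Extra u v
  not-extra ¬corner tri = ¬corner (proj₁ (InTriangle⇒corners bs tri))

  interior-nonadjacent : ∀ {s t} → s ≢ t → u ∈ m s → v ∈ T t → ¬ E G u v
  interior-nonadjacent s≢t u∈ v∈ =
    apart⇒nonadjacent (tail-only (∈-++⁺ˡ u∈)) (tail-only v∈) s≢t
      (not-extra (interior-not-bottom u∈))

  interior-apex-nonadjacent : ∀ {s} → v ∈ m s →
                              Consec (a ∷ T s) a w → Consec (a ∷ T s) w v → ¬ E G a v
  interior-apex-nonadjacent v∈ = apex-nonadjacent (tail-only (∈-++⁺ˡ v∈)) (not-extra apex-not-bottom)

  bottom-adjacent : ∀ {s t} → s ≢ t → E G (bs s) (bs t)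
  bottom-adjacent {t = t} s≢t = Equivalence.from (adjacency _ _) (inj₂ (inj₂ (inj₂
    (corners⇒InTriangle bs (apart⇒distinct (tail-only (bottom∈ _)) (there (bottom∈ t)) s≢t)))))

  three-nonempty⇒P4+P1 : ∀ i j k → k ≢ i → k ≢ j → i ≢ j →
                         u ∈ m k → Consec (T k) u (bs k) → w ∈ m i → Consec (T i) w (bs i) →
                         x ∈ m j → ContainsInduced G P4+P1
  three-nonempty⇒P4+P1 i _ k k≢i k≢j i≢j u∈ ub w∈ wb x∈ =
    induced-P4+P1 simple _ (bs k) (bs i) _ _
      (consec⇒adjacent (there ub)) (bottom-adjacent k≢i) (consec⇒adjacent′ (there wb))
      (interior-nonadjacent k≢i u∈ (bottom∈ i)) (interior-nonadjacent k≢i u∈ (∈-++⁺ˡ w∈))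
      (nonadjacent-sym simple (interior-nonadjacent (≢-sym k≢i) w∈ (bottom∈ k)))
      (interior-nonadjacent (≢-sym k≢j) x∈ (∈-++⁺ˡ u∈))
      (interior-nonadjacent (≢-sym k≢j) x∈ (bottom∈ k))
      (interior-nonadjacent (≢-sym i≢j) x∈ (bottom∈ i))
      (interior-nonadjacent (≢-sym i≢j) x∈ (∈-++⁺ˡ w∈))

  empty-and-short⇒C4 : ∀ i k → k ≢ i → m k ≡ [] →
                       x ∈ m i → Consec (a ∷ T i) a x → Consec (a ∷ T i) x (bs i) →
                       ContainsInduced G C4
  empty-and-short⇒C4 i k k≢i m-k≡[] x∈ ax xb =
    induced-C4 simple a _ (bs i) (bs k)
      (consec⇒adjacent ax) (consec⇒adjacent xb) (bottom-adjacent (≢-sym k≢i))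
      (consec⇒adjacent′ (consec-empty m-k≡[]))
      a-b-nonadjacent (interior-nonadjacent (≢-sym k≢i) x∈ (bottom∈ k))
      (λ a≡b → apex-not-bottom (i , a≡b))
      (apart⇒distinct (tail-only (∈-++⁺ˡ x∈)) (there (bottom∈ k)) (≢-sym k≢i))
    where
    a-b-nonadjacent : ¬ E G a (bs i)
    a-b-nonadjacent e with apex-neighbour (tail-only (bottom∈ i)) (not-extra apex-not-bottom) e ax
    ... | b≡x = interior-not-bottom x∈ (i , sym b≡x)

  empty-and-two-long⇒P4+P1 : ∀ i j k → k ≢ i → k ≢ j → i ≢ j → m k ≡ [] →
                             x ∈ m i → y ∈ m i → Consec (a ∷ T i) a x → Consec (a ∷ T i) x y →
                             z ∈ m j → Consec (a ∷ T j) a w → Consec (a ∷ T j) w z →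
                             ContainsInduced G P4+P1
  empty-and-two-long⇒P4+P1 _ _ k k≢i k≢j i≢j m-k≡[] x∈ y∈ ax xy z∈ aw wz =
    induced-P4+P1 simple (bs k) a _ _ _
      (consec⇒adjacent′ (consec-empty m-k≡[])) (consec⇒adjacent ax) (consec⇒adjacent xy)
      (nonadjacent-sym simple (interior-nonadjacent (≢-sym k≢i) x∈ (bottom∈ k)))
      (nonadjacent-sym simple (interior-nonadjacent (≢-sym k≢i) y∈ (bottom∈ k)))
      (interior-apex-nonadjacent y∈ ax xy)
      (interior-nonadjacent (≢-sym k≢j) z∈ (bottom∈ k))
      (nonadjacent-sym simple (interior-apex-nonadjacent z∈ aw wz))
      (interior-nonadjacent (≢-sym i≢j) z∈ (∈-++⁺ˡ x∈))
      (interior-nonadjacent (≢-sym i≢j) z∈ (∈-++⁺ˡ y∈))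

  one-empty : ∀ i j k → k ≢ i → k ≢ j → i ≢ j → m k ≡ [] →
              Beginning a (bs i) (m i) → Beginning a (bs j) (m j) →
              ContainsInduced G P4+P1 ⊎ ContainsInduced G C4
  one-empty i _ k k≢i k≢j i≢j m-k≡[] (short x∈ ax xb) _ =
    inj₂ (empty-and-short⇒C4 i k k≢i m-k≡[] x∈ ax xb)
  one-empty _ j k k≢i k≢j i≢j m-k≡[] (long _ _ _ _) (short y∈ ay yb) =
    inj₂ (empty-and-short⇒C4 j k k≢j m-k≡[] y∈ ay yb)
  one-empty i j k k≢i k≢j i≢j m-k≡[] (long x∈ y∈ ax xy) (long _ z∈ aw wz) =
    inj₁ (empty-and-two-long⇒P4+P1 i j k k≢i k≢j i≢j m-k≡[] x∈ y∈ ax xy z∈ aw wz)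

  contains : ContainsInduced G P4+P1 ⊎ ContainsInduced G C4
  contains = cases (shape 0F) (shape 1F) (shape 2F)
    where
    Shape : Fin 3 → Set
    Shape i = m i ≡ [] ⊎ Beginning a (bs i) (m i)

    shape : ∀ i → Shape i
    shape i = empty-or-beginning (m i)

    cases : Shape 0F → Shape 1F → Shape 2F → ContainsInduced G P4+P1 ⊎ ContainsInduced G C4
    cases (inj₂ s₀) (inj₂ s₁) (inj₂ s₂)
      with first-interior s₀ | first-interior s₁ | first-interior s₂
    ... | _ , x₀∈ , _ | _ , x₁∈ , _ | _ , x₂∈ , _
      with last-interior (m 0F) x₀∈ | last-interior (m 1F) x₁∈
    ... | _ , u∈ , ub | _ , w∈ , wb =
      inj₁ (three-nonempty⇒P4+P1 1F 2F 0F (λ ()) (λ ()) (λ ()) u∈ ub w∈ wb x₂∈)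
    cases (inj₁ e₀) (inj₂ s₁) (inj₂ s₂) = one-empty 1F 2F 0F (λ ()) (λ ()) (λ ()) e₀ s₁ s₂
    cases (inj₂ s₀) (inj₁ e₁) (inj₂ s₂) = one-empty 0F 2F 1F (λ ()) (λ ()) (λ ()) e₁ s₀ s₂
    cases (inj₂ s₀) (inj₂ s₁) (inj₁ e₂) = one-empty 0F 1F 2F (λ ()) (λ ()) (λ ()) e₂ s₀ s₁
    cases (inj₁ e₀) (inj₁ e₁) _ =
      ⊥-elim (AtLeastTwo⇒¬¬ two-nonempty (empty⇒¬NonEmpty e₀) (empty⇒¬NonEmpty e₁))
    cases (inj₂ _) (inj₁ e₁) (inj₁ e₂) =
      ⊥-elim (AtLeastTwo⇒¬¬ (AtLeastTwo-rotate two-nonempty)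
                           (empty⇒¬NonEmpty e₁) (empty⇒¬NonEmpty e₂))
    cases (inj₁ e₀) (inj₂ _) (inj₁ e₂) =
      ⊥-elim (AtLeastTwo⇒¬¬ (AtLeastTwo-rotate (AtLeastTwo-rotate two-nonempty))
                           (empty⇒¬NonEmpty e₂) (empty⇒¬NonEmpty e₀))

-- Broken wheels

module Modular (K : ℕ) where

  infix 4 _≋_
  _≋_ : ℕ → ℕ → Set
  p ≋ q = p % suc K ≡ q % suc K

  +-congʳ-≋ : ∀ p q r → p ≋ q → p + r ≋ q + r
  +-congʳ-≋ p q r p≋q = begin
    (p + r) % suc K                 ≡⟨ %-distribˡ-+ p r (suc K) ⟩
    (p % suc K + r % suc K) % suc K ≡⟨ cong (λ z → (z + r % suc K) % suc K) p≋q ⟩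
    (q % suc K + r % suc K) % suc K ≡⟨ %-distribˡ-+ q r (suc K) ⟨
    (q + r) % suc K                 ∎
    where open ≡-Reasoning

  -- Adding K undoes adding 1.
  +1-cancelʳ-≋ : ∀ {p q} → p + 1 ≋ q + 1 → p ≋ q
  +1-cancelʳ-≋ {p} {q} p+1≋q+1 = begin
    p % suc K             ≡⟨ [m+n]%n≡m%n p (suc K) ⟨
    (p + suc K) % suc K   ≡⟨ cong (_% suc K) (+-assoc p 1 K) ⟨
    (p + 1 + K) % suc K   ≡⟨ +-congʳ-≋ (p + 1) (q + 1) K p+1≋q+1 ⟩
    (q + 1 + K) % suc K   ≡⟨ cong (_% suc K) (+-assoc q 1 K) ⟩
    (q + suc K) % suc K   ≡⟨ [m+n]%n≡m%n q (suc K) ⟩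
    q % suc K             ∎
    where open ≡-Reasoning

  +-cancelʳ-≋ : ∀ p q r → p + r ≋ q + r → p ≋ q
  +-cancelʳ-≋ p q zero p≋q rewrite +-identityʳ p | +-identityʳ q = p≋q
  +-cancelʳ-≋ p q (suc r) p≋q
    rewrite +-suc p r | +-suc q r | +-comm 1 (p + r) | +-comm 1 (q + r) =
    +-cancelʳ-≋ p q r (+1-cancelʳ-≋ {p + r} {q + r} p≋q)

  +-cancelˡ-≋ : ∀ p q r → r + p ≋ r + q → p ≋ q
  +-cancelˡ-≋ p q r rewrite +-comm r p | +-comm r q = +-cancelʳ-≋ p q r

  ≡⇒≋ : ∀ {p q} → p ≡ q → p ≋ q
  ≡⇒≋ = cong (_% suc K)

  ≋⇒≡ : ∀ {p q} → p < suc K → q < suc K → p ≋ q → p ≡ q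
  ≋⇒≡ p< q< p≋q = trans (sym (m<n⇒m%n≡m p<)) (trans p≋q (m<n⇒m%n≡m q<))

module Hole {G : Graph} (k′ : ℕ) (c : Fin (4 + k′) → V G)
  (c-injective : ∀ i j → c i ≡ c j → i ≡ j)
  (c-adjacency : ∀ i j → E G (c i) (c j) ⇔
                   (toℕ j ≡ (toℕ i + 1) % (4 + k′) ⊎ toℕ i ≡ (toℕ j + 1) % (4 + k′))) where

  open Modular (3 + k′) public

  C : ℕ → V G
  C p = c (cyc (4 + k′) p)

  private
    toℕ-cyc : ∀ p → toℕ (cyc (4 + k′) p) ≡ p % (4 + k′)
    toℕ-cyc p = toℕ-fromℕ< (m%n<n p (4 + k′))

    toℕ-cyc-+1 : ∀ p → (toℕ (cyc (4 + k′) p) + 1) % (4 + k′) ≡ (p + 1) % (4 + k′)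
    toℕ-cyc-+1 p = trans (cong (λ z → (z + 1) % (4 + k′)) (toℕ-cyc p))
                         (+-congʳ-≋ (p % (4 + k′)) p 1 (m%n%n≡m%n p (4 + k′)))

    offset< : ∀ {r} → r ≤ 3 → r < 4 + k′
    offset< r≤3 = s≤s (≤-trans r≤3 (m≤m+n 3 k′))

  C-toℕ : ∀ i → C (toℕ i) ≡ c i
  C-toℕ i = cong c (toℕ-injective (trans (toℕ-cyc (toℕ i)) (m<n⇒m%n≡m (toℕ<n i))))

  ≋⇒C≡ : ∀ p q → p ≋ q → C p ≡ C q
  ≋⇒C≡ p q p≋q = cong c (toℕ-injective (trans (toℕ-cyc p) (trans p≋q (sym (toℕ-cyc q)))))

  C≡⇒≋ : ∀ p q → C p ≡ C q → p ≋ q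
  C≡⇒≋ p q Cp≡Cq =
    trans (sym (toℕ-cyc p)) (trans (cong toℕ (c-injective _ _ Cp≡Cq)) (toℕ-cyc q))

  C-adjacent : ∀ p → E G (C p) (C (p + 1))
  C-adjacent p =
    Equivalence.from (c-adjacency _ _) (inj₁ (trans (toℕ-cyc (p + 1)) (sym (toℕ-cyc-+1 p))))

  C-adjacent₂ : ∀ p → E G (C (p + 1)) (C (p + 2))
  C-adjacent₂ p = subst (λ q → E G (C (p + 1)) (C q)) (+-assoc p 1 1) (C-adjacent (p + 1))

  C-adjacent⇒ : ∀ p q → E G (C p) (C q) → q ≋ p + 1 ⊎ p ≋ q + 1
  C-adjacent⇒ p q e with Equivalence.to (c-adjacency _ _) e
  ... | inj₁ h = inj₁ (trans (sym (toℕ-cyc q)) (trans h (toℕ-cyc-+1 p)))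
  ... | inj₂ h = inj₂ (trans (sym (toℕ-cyc p)) (trans h (toℕ-cyc-+1 q)))

  neighbours-of-successor : ∀ q r → E G (C (q + 1)) (C r) → r ≋ q + 2 ⊎ r ≋ q
  neighbours-of-successor q r e with C-adjacent⇒ (q + 1) r e
  ... | inj₁ h = inj₁ (trans h (≡⇒≋ (+-assoc q 1 1)))
  ... | inj₂ h = inj₂ (sym (+-cancelʳ-≋ q r 1 h))

  offsets-distinct : ∀ p r s → r ≤ 3 → s ≤ 3 → r ≢ s → ¬ (p + r ≋ p + s)
  offsets-distinct p r s r≤3 s≤3 r≢s h =
    r≢s (≋⇒≡ (offset< r≤3) (offset< s≤3) (+-cancelˡ-≋ r s p h))

  C-chordless : ∀ p → ¬ E G (C p) (C (p + 2))
  C-chordless p e with C-adjacent⇒ p (p + 2) e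
  ... | inj₁ h = offsets-distinct p 2 1 (s≤s (s≤s z≤n)) (s≤s z≤n) (λ ()) h
  ... | inj₂ h = offsets-distinct p 0 3 z≤n (s≤s (s≤s (s≤s z≤n))) (λ ())
                   (trans (≡⇒≋ (+-identityʳ p)) (trans h (≡⇒≋ (+-assoc p 2 1))))

  C-distinct : ∀ p → C p ≢ C (p + 2)
  C-distinct p Cp≡ = offsets-distinct p 0 2 z≤n (s≤s (s≤s z≤n)) (λ ())
                       (trans (≡⇒≋ (+-identityʳ p)) (C≡⇒≋ p (p + 2) Cp≡))

module Wheel {G : Graph} (simple : SimpleGraph G) (k′ : ℕ) (c : Fin (4 + k′) → V G) (x : V G)
  (c-injective : ∀ i j → c i ≡ c j → i ≡ j)
  (c-adjacency : ∀ i j → E G (c i) (c j) ⇔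
                   (toℕ j ≡ (toℕ i + 1) % (4 + k′) ⊎ toℕ i ≡ (toℕ j + 1) % (4 + k′)))
  (c≢x : ∀ i → c i ≢ x) where

  open Hole {G} k′ c c-injective c-adjacency

  ShortSector LongSector : ℕ → Set
  ShortSector p = E G x (C p) × ¬ E G x (C (p + 1)) × E G x (C (p + 2))
  LongSector  p = E G x (C p) × ¬ E G x (C (p + 1)) × ¬ E G x (C (p + 2))

  sector-short-or-long : ∀ i d → 2 ≤ d → IsSector G (4 + k′) c x i d →
                         ShortSector (toℕ i) ⊎ LongSector (toℕ i)
  sector-short-or-long i (suc zero) (s≤s ()) _
  sector-short-or-long i (suc (suc zero)) _ (_ , x-c-i , x-end , interior) =
    inj₁ (subst (E G x) (sym (C-toℕ i)) x-c-i , interior 1 (s≤s z≤n) (s≤s (s≤s z≤n)) , x-end)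
  sector-short-or-long i (suc (suc (suc d))) _ (_ , x-c-i , _ , interior) =
    inj₂ (subst (E G x) (sym (C-toℕ i)) x-c-i , interior 1 (s≤s z≤n) (s≤s (s≤s z≤n))
         , interior 2 (s≤s z≤n) (s≤s (s≤s (s≤s z≤n))))

  short-sector⇒C4 : ∀ p → ShortSector p → ContainsInduced G C4
  short-sector⇒C4 p (x-p , ¬x-p+1 , x-p+2) =
    induced-C4 simple x (C p) (C (p + 1)) (C (p + 2))
      x-p (C-adjacent p) (C-adjacent₂ p) (adjacent-sym simple x-p+2)
      ¬x-p+1 (C-chordless p) (λ x≡ → c≢x _ (sym x≡)) (C-distinct p)

  two-long-sectors⇒P4+P1 : ∀ p q → ¬ (p ≋ q) → LongSector p → LongSector q → ContainsInduced G P4+P1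
  two-long-sectors⇒P4+P1 p q p≉q (x-p , ¬x-p+1 , ¬x-p+2) (x-q , ¬x-q+1 , ¬x-q+2) =
    induced-P4+P1 simple x (C p) (C (p + 1)) (C (p + 2)) (C (q + 1))
      x-p (C-adjacent p) (C-adjacent₂ p) ¬x-p+1 ¬x-p+2 (C-chordless p)
      (nonadjacent-sym simple ¬x-q+1) ¬y-p ¬y-p+1 ¬y-p+2
    where
    sees : ∀ r s → r ≋ s → E G x (C r) → E G x (C s)
    sees r s r≋s = subst (E G x) (≋⇒C≡ r s r≋s)

    ¬y-p : ¬ E G (C (q + 1)) (C p)
    ¬y-p e with neighbours-of-successor q p e
    ... | inj₁ p≋q+2 = ¬x-q+2 (sees p (q + 2) p≋q+2 x-p)
    ... | inj₂ p≋q   = p≉q p≋q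

    ¬y-p+1 : ¬ E G (C (q + 1)) (C (p + 1))
    ¬y-p+1 e with neighbours-of-successor q (p + 1) e
    ... | inj₁ p+1≋q+2 =
      ¬x-q+1 (sees p (q + 1) (+-cancelʳ-≋ p (q + 1) 1 (trans p+1≋q+2 (≡⇒≋ (sym (+-assoc q 1 1))))) x-p)
    ... | inj₂ p+1≋q   = ¬x-p+1 (sees q (p + 1) (sym p+1≋q) x-q)

    ¬y-p+2 : ¬ E G (C (q + 1)) (C (p + 2))
    ¬y-p+2 e with neighbours-of-successor q (p + 2) e
    ... | inj₁ p+2≋q+2 = p≉q (+-cancelʳ-≋ p q 2 p+2≋q+2)
    ... | inj₂ p+2≋q   = ¬x-p+2 (sees q (p + 2) (sym p+2≋q) x-q)

  contains : ∀ i d i′ d′ → i ≢ i′ → 2 ≤ d → 2 ≤ d′ →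
             IsSector G (4 + k′) c x i d → IsSector G (4 + k′) c x i′ d′ →
             ContainsInduced G P4+P1 ⊎ ContainsInduced G C4
  contains i d i′ d′ i≢i′ 2≤d 2≤d′ sector sector′
    with sector-short-or-long i d 2≤d sector | sector-short-or-long i′ d′ 2≤d′ sector′
  ... | inj₁ short-i | _            = inj₂ (short-sector⇒C4 (toℕ i) short-i)
  ... | inj₂ _       | inj₁ short-i′ = inj₂ (short-sector⇒C4 (toℕ i′) short-i′)
  ... | inj₂ long-i  | inj₂ long-i′  =
    inj₁ (two-long-sectors⇒P4+P1 (toℕ i) (toℕ i′) distinct-starts long-i long-i′)
    where
    distinct-starts : ¬ (toℕ i ≋ toℕ i′)
    distinct-starts i≋i′ = i≢i′ (toℕ-injective (≋⇒≡ (toℕ<n i) (toℕ<n i′) i≋i′))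

lemma6p2 : (H : Graph) → SimpleGraph H →
           (IsLongPrism H ⊎ IsPyramid H ⊎ IsTheta H ⊎ IsBrokenWheel H) →
           ContainsInduced H P4+P1 ⊎ ContainsInduced H C4
lemma6p2 H simple (inj₁ (a₁ , b₁ , a₂ , b₂ , a₃ , b₃ , m₁ , m₂ , m₃ , (unique , _ , adjacency) , _)) =
  Prism.contains simple (triple a₁ a₂ a₃) (triple b₁ b₂ b₃) (triple m₁ m₂ m₃) unique adjacency
lemma6p2 H simple (inj₂ (inj₁ (a , b₁ , b₂ , b₃ , m₁ , m₂ , m₃ , unique , _ , two-nonempty , adjacency))) =
  Pyramid.contains simple a (triple b₁ b₂ b₃) (triple m₁ m₂ m₃) unique adjacency two-nonempty
lemma6p2 H simple (inj₂ (inj₂ (inj₁ (a , b , m₁ , m₂ , m₃ , unique , _ , n₁ , n₂ , n₃ , adjacency)))) =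
  Theta.contains simple a b (triple m₁ m₂ m₃) unique adjacency n₁ n₂ n₃
lemma6p2 H simple (inj₂ (inj₂ (inj₂ (k′ , c , x , c-injective , c-adjacency , c≢x , _ , _ ,
                                    i , d , i′ , d′ , i≢i′ , 2≤d , 2≤d′ , sector , sector′)))) =
  Wheel.contains simple k′ c x c-injective c-adjacency c≢x i d i′ d′ i≢i′ 2≤d 2≤d′ sector sector′
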